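{- Let $S_k^p$ be a generalized sunlet graph. If $k$ and $p$ are both odd, or if $k$ is even (and $p$ arbitrary), then $S_k^p$ has an ESD labeling with label set $L=\{1,\dots,(p+1)k-2\}$.
   Context: For $k\ge 3$ and $p\ge 1$, the generalized sunlet graph $S_k^p$ is the unicyclic graph obtained from a cycle $C_k$ with vertices $c_1,\dots,c_k$ by attaching, for each $i\in\{1,\dots,k\}$, a path $R_i$ on $p$ vertices so that one endpoint of $R_i$ is identified with $c_i$ (the paths are otherwise disjoint). For a graph $G=(V,E)$ and $l\in\mathbb N$, a vertex labeling $\phi:V\to L=\{1,\dots,l\}$ is an edge-sum distinguishing (ESD) labeling if $\phi$ is injective and the edge-weights $w_\phi(uv)=\phi(u)+\phi(v)$ are pairwise distinct over all edges $uv\in E$. -}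

module Defs where

open import Data.Nat using (ℕ; zero; suc; _+_; _*_; _∸_; _<_; _≤_)
open import Data.Nat.Properties using (<-trans; n<1+n)
open import Data.Nat.DivMod using (_%_; m%n<n)
open import Data.Fin using (Fin; toℕ; fromℕ<)
open import Data.Product using (_×_; _,_; proj₁; proj₂)
open import Function.Definitions using (Injective)
open import Relation.Binary.PropositionalEquality using (_≡_)

-- Vertices of the generalized sunlet graph S_k^p:
-- (i , j) is the j-th vertex (0-based) of the path R_i (which has p vertices);
-- (i , 0) is the cycle vertex c_i.
Vertex : ℕ → ℕ → Set
Vertex k p = Fin k × Fin p

next : {k : ℕ} → Fin k → Fin k
next {suc n} i = fromℕ< (m%n<n (suc (toℕ i)) (suc n))

-- Edges of S_k^p: cycle edges c_i c_{i+1 mod k} (these exist when p ≥ 1),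
-- and path edges of R_i between its j-th and (j+1)-th vertices (j + 1 < p).
data Edge (k p : ℕ) : Set where
  cyc : Fin k → 0 < p → Edge k p
  pth : Fin k → (j : ℕ) → suc j < p → Edge k p

ends : {k p : ℕ} → Edge k p → Vertex k p × Vertex k p
ends (cyc i 0<p) = (i , fromℕ< 0<p) , (next i , fromℕ< 0<p)
ends (pth i j sj<p) = (i , fromℕ< (<-trans (n<1+n j) sj<p)) , (i , fromℕ< sj<p)

weight : {k p : ℕ} → (Vertex k p → ℕ) → Edge k p → ℕ
weight φ e = φ (proj₁ (ends e)) + φ (proj₂ (ends e))

IsESDLabeling : (k p l : ℕ) → (Vertex k p → ℕ) → Set
IsESDLabeling k p l φ =
  ((v : Vertex k p) → 1 ≤ φ v × φ v ≤ l)
  × Injective _≡_ _≡_ φ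
  × Injective _≡_ _≡_ (weight {k} {p} φ)

module Submission where

-- Proof idea (K = k ≥ 3).  First label the cycle C_K on its own: an injective
-- labeling with labels in {1, …, K} whose K cycle edge sums are pairwise distinct.
-- For odd K the labels 1, 2, …, K in cyclic order work (edge sums 3, 5, …, 2K - 1
-- and the even closing sum K + 1); for even K the order 2, 1, 3, 4, …, K works
-- (edge sums 3, 4, 7, 9, …, 2K - 1 and the even closing sum K + 2).
-- Then lift it to S_K^p layer by layer: the j-th vertex of every path R_i gets
-- label(c_i) + B j, where B 0 = 0 and B (1 + j) = (2 + j) K - 2.  The bases B are
-- at least K apart, so the layers of vertex labels are disjoint windows; the path
-- edges between layers j and j + 1 weigh 2 label(c_i) + B j + B (1 + j), and these
-- bases are at least 2K apart and all exceed the cycle edge sums (< 2K).  The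
-- largest label is K + B (p - 1) = (p + 1) K - 2.
-- The construction works for every k ≥ 3 and p ≥ 1.

open import Defs
open import Data.Nat using (ℕ; zero; suc; _+_; _*_; _∸_; _≤_; _<_; z≤n; s≤s; s≤s⁻¹)
open import Data.Nat.Properties
open import Data.Nat.DivMod using (_%_; m<n⇒m%n≡m; n%n≡0)
open import Data.Nat.Divisibility using (_∣_; _∣?_; divides)
open import Data.Nat.Tactic.RingSolver using (solve-∀)
open import Data.Fin using (Fin; toℕ)
open import Data.Fin.Properties using (toℕ-fromℕ<; toℕ-injective; toℕ<n)
open import Data.Product using (_×_; Σ; _,_; proj₁; proj₂)
open import Data.Sum using (_⊎_; inj₁; inj₂)
open import Function.Definitions using (Injective)
open import Relation.Nullary using (¬_; yes; no; contradiction)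
open import Relation.Binary using (tri<; tri≈; tri>)
open import Relation.Binary.PropositionalEquality

-- F is layered with width w when consecutive values are at least w apart; then
-- the windows {F j + 1, …, F j + w} are pairwise disjoint.
-- (A record, so that F and w can be inferred from a proof of layeredness.)
record Layered (F : ℕ → ℕ) (w : ℕ) : Set where
  constructor layered
  field step : ∀ j → w + F j ≤ F (suc j)
open Layered

layered-< : ∀ {F w} → Layered F w → ∀ {j j'} → j < j' → w + F j ≤ F j'
layered-< {F} {w} L {j} {suc j'} (s≤s j≤j') with m≤n⇒m<n∨m≡n j≤j'
... | inj₁ j<j' = ≤-trans (layered-< L j<j') (≤-trans (m≤n+m (F j') w) (step L j'))
... | inj₂ refl = step L j

layered-≤ : ∀ {F w} → Layered F w → ∀ {j j'} → j ≤ j' → F j ≤ F j'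
layered-≤ {F} {w} L {j} j≤j' with m≤n⇒m<n∨m≡n j≤j'
... | inj₁ j<j' = ≤-trans (m≤n+m (F j) w) (layered-< L j<j')
... | inj₂ refl = ≤-refl

window-< : ∀ {F w} → Layered F w → ∀ {j j' a b} → a ≤ w → 1 ≤ b → j < j' →
           a + F j < b + F j'
window-< {F} {w} L {j} {j'} {a} {b} a≤w 1≤b j<j' = begin-strict
  a + F j  ≤⟨ +-monoˡ-≤ (F j) a≤w ⟩
  w + F j  ≤⟨ layered-< L j<j' ⟩
  F j'     <⟨ m<n+m (F j') 1≤b ⟩
  b + F j' ∎
  where open ≤-Reasoning

window-unique : ∀ {F w} → Layered F w → ∀ {j j' a b} → 1 ≤ a → a ≤ w → 1 ≤ b → b ≤ w →
                a + F j ≡ b + F j' → j ≡ j' × a ≡ b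
window-unique {F} L {j} {j'} {a} {b} 1≤a a≤w 1≤b b≤w eq with <-cmp j j'
... | tri< j<j' _ _ = contradiction eq (<⇒≢ (window-< L a≤w 1≤b j<j'))
... | tri≈ _ refl _ = refl , +-cancelʳ-≡ (F j) a b eq
... | tri> _ _ j'<j = contradiction (sym eq) (<⇒≢ (window-< L b≤w 1≤a j'<j))

increasing-injective : ∀ {F} → Layered F 1 → Injective _≡_ _≡_ F
increasing-injective L eq = proj₁ (window-unique L ≤-refl ≤-refl ≤-refl ≤-refl (cong suc eq))

layered-twoSteps : ∀ {F w} → Layered F w → ∀ j → (w + w) + F j ≤ F (2 + j)
layered-twoSteps {F} {w} L j = begin
  (w + w) + F j    ≡⟨ +-assoc w w (F j) ⟩
  w + (w + F j)    ≤⟨ +-monoʳ-≤ w (step L j) ⟩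
  w + F (suc j)    ≤⟨ step L (suc j) ⟩
  F (2 + j)        ∎
  where open ≤-Reasoning

neighbourSums-layered : (F : ℕ → ℕ) {w : ℕ} → (∀ j → w + F j ≤ F (2 + j)) →
                        Layered (λ j → F j + F (suc j)) w
neighbourSums-layered F {w} grow = layered λ j → begin
  w + (F j + F (suc j)) ≡⟨ regroup w (F j) (F (suc j)) ⟩
  F (suc j) + (w + F j) ≤⟨ +-monoʳ-≤ (F (suc j)) (grow j) ⟩
  F (suc j) + F (2 + j) ∎
  where
  open ≤-Reasoning
  regroup : ∀ x y z → x + (y + z) ≡ z + (x + y)
  regroup = solve-∀

double-injective : ∀ {x y} → x + x ≡ y + y → x ≡ y
double-injective {x} {y} eq with <-cmp x y
... | tri< x<y _ _ = contradiction eq (<⇒≢ (+-mono-< x<y x<y))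
... | tri≈ _ x≡y _ = x≡y
... | tri> _ _ y<x = contradiction (sym eq) (<⇒≢ (+-mono-< y<x y<x))

distinct-sum-< : ∀ {x y K} → x ≤ K → y ≤ K → x ≢ y → x + y < K + K
distinct-sum-< {x} {y} x≤K y≤K x≢y with m≤n⇒m<n∨m≡n x≤K
... | inj₁ x<K = +-mono-<-≤ x<K y≤K
... | inj₂ refl = +-monoʳ-< x (≤∧≢⇒< y≤K (≢-sym x≢y))

odd-not-even : ∀ b → ¬ 2 ∣ suc (2 * b)
odd-not-even b (divides q eq) = even≢odd q b (trans (*-comm 2 q) (sym eq))

next-cases : ∀ {m} (i : Fin (suc m)) →
             (toℕ i < m × toℕ (next i) ≡ suc (toℕ i)) ⊎ (toℕ i ≡ m × toℕ (next i) ≡ 0)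
next-cases {m} i with m≤n⇒m<n∨m≡n (s≤s⁻¹ (toℕ<n i))
... | inj₁ i<m = inj₁ (i<m , trans (toℕ-fromℕ< _) (m<n⇒m%n≡m (s≤s i<m)))
... | inj₂ i≡m = inj₂ (i≡m , trans (toℕ-fromℕ< _)
                                (trans (cong (λ x → suc x % suc m) i≡m) (n%n≡0 (suc m))))

next-≢ : ∀ {n} (i : Fin (2 + n)) → next i ≢ i
next-≢ i next≡i with next-cases i
... | inj₁ (_ , e) = 1+n≢n (trans (sym e) (cong toℕ next≡i))
... | inj₂ (i≡m , e) = 1+n≢0 (trans (sym i≡m) (trans (cong toℕ (sym next≡i)) e))

record CycleLabeling (K : ℕ) : Set where
  field
    label : Fin K → ℕ
    label-bounds : ∀ i → 1 ≤ label i × label i ≤ K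
    label-injective : Injective _≡_ _≡_ label
    edge-injective : Injective _≡_ _≡_ (λ i → label i + label (next i))

edgeSum-< : ∀ {n} (C : CycleLabeling (2 + n)) (i : Fin (2 + n)) →
            let open CycleLabeling C in label i + label (next i) < (2 + n) + (2 + n)
edgeSum-< C i = distinct-sum-< (proj₂ (label-bounds i)) (proj₂ (label-bounds (next i)))
                  (λ e → next-≢ i (sym (label-injective e)))
  where open CycleLabeling C

sequenceCycleLabeling : ∀ m (f : ℕ → ℕ) →
  (∀ a → a < suc m → 1 ≤ f a × f a ≤ suc m) →
  Injective _≡_ _≡_ f →
  (∀ a → f a < f (2 + a)) →
  (∀ a → a < m → f a + f (suc a) ≢ f 0 + f m) →
  CycleLabeling (suc m)
sequenceCycleLabeling m f bounds f-injective grow closing = record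
  { label = λ i → f (toℕ i)
  ; label-bounds = λ i → bounds (toℕ i) (toℕ<n i)
  ; label-injective = λ eq → toℕ-injective (f-injective eq)
  ; edge-injective = edge-injective
  }
  where
  edgeSum : Fin (suc m) → ℕ
  edgeSum i = f (toℕ i) + f (toℕ (next i))

  edgeSum-cases : ∀ i → (toℕ i < m × edgeSum i ≡ f (toℕ i) + f (suc (toℕ i)))
                        ⊎ (toℕ i ≡ m × edgeSum i ≡ f 0 + f m)
  edgeSum-cases i with next-cases i
  ... | inj₁ (i<m , e) = inj₁ (i<m , cong (λ x → f (toℕ i) + f x) e)
  ... | inj₂ (i≡m , e) = inj₂ (i≡m , trans (cong₂ (λ x y → f x + f y) i≡m e) (+-comm (f m) (f 0)))

  edge-injective : Injective _≡_ _≡_ edgeSum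
  edge-injective {i} {i'} eq with edgeSum-cases i | edgeSum-cases i'
  ... | inj₁ (_ , e) | inj₁ (_ , e') =
        toℕ-injective (increasing-injective (neighbourSums-layered f grow) (trans (sym e) (trans eq e')))
  ... | inj₁ (i<m , e) | inj₂ (_ , e') = contradiction (trans (sym e) (trans eq e')) (closing _ i<m)
  ... | inj₂ (_ , e) | inj₁ (i'<m , e') = contradiction (trans (sym e') (trans (sym eq) e)) (closing _ i'<m)
  ... | inj₂ (i≡m , _) | inj₂ (i'≡m , _) = toℕ-injective (trans i≡m (sym i'≡m))

-- Odd cycles: the labels 1, 2, …, K in order.  The neighbour sums 2a + 3 are odd,
-- the closing sum K + 1 is even.
oddCycleLabeling : ∀ m → ¬ 2 ∣ suc m → CycleLabeling (suc m)
oddCycleLabeling m odd =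
  sequenceCycleLabeling m suc (λ _ a<K → s≤s z≤n , a<K) suc-injective
    (λ a → s≤s (s≤s (n≤1+n a))) closing
  where
  neighbourSum : ∀ a → suc a + suc (suc a) ≡ suc (suc a * 2)
  neighbourSum = solve-∀

  closing : ∀ a → a < m → suc a + suc (suc a) ≢ 1 + suc m
  closing a _ eq = odd (divides (suc a) (sym (suc-injective (trans (sym (neighbourSum a)) eq))))

swapFirstTwo : ℕ → ℕ
swapFirstTwo zero = 2
swapFirstTwo (suc zero) = 1
swapFirstTwo (suc (suc a)) = 3 + a

swapFirstTwo-injective : Injective _≡_ _≡_ swapFirstTwo
swapFirstTwo-injective {zero} {zero} _ = refl
swapFirstTwo-injective {suc zero} {suc zero} _ = refl
swapFirstTwo-injective {suc (suc a)} {suc (suc b)} eq = cong (λ x → 2 + x) (+-cancelˡ-≡ 3 a b eq)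
swapFirstTwo-injective {zero} {suc (suc b)} eq = contradiction (suc-injective (suc-injective eq)) (≢-sym 1+n≢0)
swapFirstTwo-injective {suc (suc a)} {zero} eq = contradiction (suc-injective (suc-injective eq)) 1+n≢0

-- The neighbour sums are 3, 4 and the odd numbers 2a + 3 (a ≥ 2); the closing sum
-- K + 2 is even and exceeds 4.
evenCycleLabeling : ∀ n → 2 ∣ 3 + n → CycleLabeling (3 + n)
evenCycleLabeling n even =
  sequenceCycleLabeling (2 + n) swapFirstTwo bounds swapFirstTwo-injective grow closing
  where
  bounds : ∀ a → a < 3 + n → 1 ≤ swapFirstTwo a × swapFirstTwo a ≤ 3 + n
  bounds zero _ = s≤s z≤n , s≤s (s≤s z≤n)
  bounds (suc zero) _ = s≤s z≤n , s≤s z≤n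
  bounds (suc (suc a)) a<K = s≤s z≤n , a<K

  grow : ∀ a → swapFirstTwo a < swapFirstTwo (2 + a)
  grow zero = ≤-refl
  grow (suc zero) = s≤s (s≤s z≤n)
  grow (suc (suc a)) = s≤s (s≤s (s≤s (s≤s (n≤1+n a))))

  neighbourSum : ∀ b → (3 + b) + (4 + b) ≡ 2 + suc (2 * (2 + b))
  neighbourSum = solve-∀

  closing : ∀ a → a < 2 + n → swapFirstTwo a + swapFirstTwo (suc a) ≢ 2 + (3 + n)
  closing zero _ ()
  closing (suc zero) _ ()
  closing (suc (suc b)) _ eq =
    odd-not-even (2 + b) (subst (2 ∣_) (suc-injective (suc-injective (trans (sym eq) (neighbourSum b)))) even)

module SunletLabeling (n : ℕ) (C : CycleLabeling (2 + n)) where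
  open CycleLabeling C

  K : ℕ
  K = 2 + n

  layerBase : ℕ → ℕ
  layerBase zero = 0
  layerBase (suc j) = suc j * K + n

  layerBase-layered : Layered layerBase K
  layerBase-layered = layered layerBase-step
    where
    layerBase-step : ∀ j → K + layerBase j ≤ layerBase (suc j)
    layerBase-step zero = m≤m+n (K + 0) n
    layerBase-step (suc j) = ≤-reflexive (sym (+-assoc K (suc j * K) n))

  pathBase : ℕ → ℕ
  pathBase j = layerBase j + layerBase (suc j)

  pathBase-layered : Layered pathBase (K + K)
  pathBase-layered = neighbourSums-layered layerBase (layered-twoSteps layerBase-layered)

  φ : ∀ {p} → Vertex K p → ℕ
  φ (i , j) = label i + layerBase (toℕ j)

  weight-cyc : ∀ {p} (i : Fin K) (q : 0 < p) → weight φ (cyc i q) ≡ label i + label (next i)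
  weight-cyc i q rewrite toℕ-fromℕ< q = cong₂ _+_ (+-identityʳ (label i)) (+-identityʳ (label (next i)))

  weight-pth : ∀ {p} (i : Fin K) (j : ℕ) (q : suc j < p) →
               weight φ (pth i j q) ≡ (label i + label i) + pathBase j
  weight-pth i j q rewrite toℕ-fromℕ< q | toℕ-fromℕ< (<-trans (n<1+n j) q) =
    regroup (label i) (layerBase j) (layerBase (suc j))
    where
    regroup : ∀ x y z → (x + y) + (x + z) ≡ (x + x) + (y + z)
    regroup = solve-∀

  largestLabel : ∀ q → K + layerBase q ≤ (suc q + 1) * K ∸ 2
  largestLabel q = ≤-trans (top q) (≤-reflexive (cong (λ x → x * K ∸ 2) (sym (+-comm (suc q) 1))))
    where
    shift : ∀ q n → (2 + n) + (suc q * (2 + n) + n) ≡ n + ((2 + n) + suc q * (2 + n))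
    shift = solve-∀
    top : ∀ q → K + layerBase q ≤ n + suc q * K
    top zero = m≤n+m (K + 0) n
    top (suc q) = ≤-reflexive (shift q n)

  cyc<pth : ∀ i i' j → label i + label (next i) < (label i' + label i') + pathBase j
  cyc<pth i i' j = begin-strict
    label i + label (next i)            <⟨ edgeSum-< C i ⟩
    K + K                               ≡⟨ doubleK n ⟩
    2 + pathBase 0                      ≤⟨ +-mono-≤ two≤ (layered-≤ pathBase-layered {j' = j} z≤n) ⟩
    (label i' + label i') + pathBase j  ∎
    where
    open ≤-Reasoning
    doubleK : ∀ n → (2 + n) + (2 + n) ≡ 2 + (0 + ((2 + n) + 0 + n))
    doubleK = solve-∀
    two≤ : 2 ≤ label i' + label i'
    two≤ = +-mono-≤ (proj₁ (label-bounds i')) (proj₁ (label-bounds i'))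

  cyc-≡ : ∀ {p} {i i' : Fin K} (q q' : 0 < p) → i ≡ i' → cyc {K} {p} i q ≡ cyc i' q'
  cyc-≡ q q' refl = cong (cyc _) (<-irrelevant q q')

  pth-≡ : ∀ {p} {i i' : Fin K} {j j'} (q : suc j < p) (q' : suc j' < p) →
          i ≡ i' → j ≡ j' → pth {K} {p} i j q ≡ pth i' j' q'
  pth-≡ q q' refl refl = cong (pth _ _) (<-irrelevant q q')

  esd : ∀ p → 1 ≤ p → Σ (Vertex K p → ℕ) (λ φ → IsESDLabeling K p ((p + 1) * K ∸ 2) φ)
  esd (suc q) _ = φ , bounds , vertex-injective , weight-injective
    where
    bounds : (v : Vertex K (suc q)) → 1 ≤ φ v × φ v ≤ (suc q + 1) * K ∸ 2
    bounds (i , j) = ≤-trans (proj₁ (label-bounds i)) (m≤m+n _ _)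
                   , ≤-trans (+-mono-≤ (proj₂ (label-bounds i))
                                       (layered-≤ layerBase-layered {j' = q} (s≤s⁻¹ (toℕ<n j))))
                             (largestLabel q)

    vertex-injective : Injective _≡_ _≡_ (φ {suc q})
    vertex-injective {i , j} {i' , j'} eq with
      window-unique layerBase-layered (proj₁ (label-bounds i)) (proj₂ (label-bounds i))
                                      (proj₁ (label-bounds i')) (proj₂ (label-bounds i')) eq
    ... | j≡j' , label≡ = cong₂ _,_ (label-injective label≡) (toℕ-injective j≡j')

    doubled-bounds : ∀ i → 1 ≤ label i + label i × label i + label i ≤ K + K
    doubled-bounds i = ≤-trans (proj₁ (label-bounds i)) (m≤m+n _ _)
                     , +-mono-≤ (proj₂ (label-bounds i)) (proj₂ (label-bounds i))

    weight-injective : Injective _≡_ _≡_ (weight {K} {suc q} φ)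
    weight-injective {cyc i r} {cyc i' r'} eq =
      cyc-≡ r r' (edge-injective (trans (sym (weight-cyc i r)) (trans eq (weight-cyc i' r'))))
    weight-injective {cyc i r} {pth i' j r'} eq =
      contradiction (trans (sym (weight-cyc i r)) (trans eq (weight-pth i' j r'))) (<⇒≢ (cyc<pth i i' j))
    weight-injective {pth i j r} {cyc i' r'} eq =
      contradiction (trans (sym (weight-cyc i' r')) (trans (sym eq) (weight-pth i j r))) (<⇒≢ (cyc<pth i' i j))
    weight-injective {pth i j r} {pth i' j' r'} eq with
      window-unique pathBase-layered (proj₁ (doubled-bounds i)) (proj₂ (doubled-bounds i))
                                     (proj₁ (doubled-bounds i')) (proj₂ (doubled-bounds i'))
                    (trans (sym (weight-pth i j r)) (trans eq (weight-pth i' j' r')))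
    ... | j≡j' , doubled≡ = pth-≡ r r' (label-injective (double-injective doubled≡)) j≡j'

theorem8 : (k p : ℕ) → 3 ≤ k → 1 ≤ p →
    ((¬ (2 ∣ k) × ¬ (2 ∣ p)) ⊎ (2 ∣ k)) →
    Σ (Vertex k p → ℕ) (λ φ → IsESDLabeling k p ((p + 1) * k ∸ 2) φ)
theorem8 (suc (suc (suc n))) p (s≤s (s≤s (s≤s z≤n))) 1≤p _ with 2 ∣? 3 + n
... | yes even = SunletLabeling.esd (suc n) (evenCycleLabeling n even) p 1≤p
... | no odd = SunletLabeling.esd (suc n) (oddCycleLabeling (2 + n) odd) p 1≤p
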